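{- Let $G$ be a block graph, let $T(G)$ be a block tree of $G$, and let $\beta=(v_1,v_2,\dots,v_n)$ be the reverse of a BFS ordering of the vertices of $T(G)$ (started at its root). If $v_iv_j\in E(G)$ with $j\ge i$, then $N_i[v_i]\subseteq N_i[v_j]$, where for a vertex $v_k$ we write $N_i[v_k]=\{v_t : v_kv_t\in E(G),\ t\ge i\}\cup\{v_k\}$.
   Context: All graphs are finite, simple and connected. A block of a graph is a maximal induced subgraph without a cut vertex; a block graph is a connected graph every block of which is complete. A block elimination ordering (BEO) of $G$ is an ordering $(u_1,\dots,u_n)$ of $V(G)$ such that for all $i<j<k\le n$, if $u_iu_j\in E$ and $u_iu_k\in E$ then $u_ju_k\in E$. Given a BEO $(u_1,\dots,u_n)$ of $G$, define $F(u_i)=u_j$ with $j=\max\{k: u_iu_k\in E\}$ for $i\ne n$ and $F(u_n)=u_n$. The block tree $T(G)$ corresponding to this BEO has vertex set $V(G)$, edge set $\{uv : u\ne v,\ F(u)=v \text{ or } F(v)=u\}$, and is rooted at $u_n$. A BFS ordering of $T(G)$ lists the vertices in breadth-first search order starting from the root; $\beta$ lists them in the reverse order, so the root is $v_n$. -}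

module Defs where

open import Data.Nat using (ℕ)
open import Data.Fin using (Fin; _≤_; _<_; opposite)
open import Data.Product using (Σ; ∃; _×_; _,_)
open import Data.Sum using (_⊎_)
open import Data.Unit using (⊤)
open import Relation.Nullary using (¬_)
open import Relation.Binary.PropositionalEquality using (_≡_; _≢_)
open import Function.Definitions using (Injective)

record Graph (n : ℕ) : Set₁ where
  field
    E     : Fin n → Fin n → Set
    irrefl : ∀ v → ¬ E v v
    sym   : ∀ u v → E u v → E v u

module _ {n : ℕ} (G : Graph n) where
  open Graph G

  -- walks from u to v all of whose vertices after u lie in S
  data Reach (S : Fin n → Set) : Fin n → Fin n → Set where
    here : ∀ {u} → Reach S u u
    step : ∀ {u w v} → E u w → S w → Reach S w v → Reach S u v

  ConnectedOn : (Fin n → Set) → Set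
  ConnectedOn S = ∀ u v → S u → S v → Reach S u v

  Connected : Set
  Connected = ConnectedOn (λ _ → ⊤)

  NoCutVertex : (Fin n → Set) → Set
  NoCutVertex S = ∀ v → S v → ConnectedOn (λ x → S x × x ≢ v)

  IsBlock : (Fin n → Set) → Set₁
  IsBlock S = (∃ λ x → S x) × ConnectedOn S × NoCutVertex S
    × (∀ (S′ : Fin n → Set) → (∀ x → S x → S′ x) → ConnectedOn S′ → NoCutVertex S′
         → ∀ x → S′ x → S x)

  IsBlockGraph : Set₁
  IsBlockGraph = Connected
    × (∀ S → IsBlock S → ∀ u v → S u → S v → u ≢ v → E u v)

-- orderings: σ i is the vertex in position i
IsOrdering : {n : ℕ} → (Fin n → Fin n) → Set
IsOrdering σ = Injective _≡_ _≡_ σ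

IsFirst : {n : ℕ} → Fin n → Set
IsFirst {n} i = ∀ (k : Fin n) → i ≤ k

IsLast : {n : ℕ} → Fin n → Set
IsLast {n} i = ∀ (k : Fin n) → k ≤ i

module _ {n : ℕ} (G : Graph n) where
  open Graph G

  IsBEO : (Fin n → Fin n) → Set
  IsBEO σ = IsOrdering σ ×
    (∀ i j k → i < j → j < k → E (σ i) (σ j) → E (σ i) (σ k) → E (σ j) (σ k))

  -- F on positions: FPos σ i j  means  F(u_i) = u_j
  FPos : (Fin n → Fin n) → Fin n → Fin n → Set
  FPos σ i j = (IsLast i × j ≡ i)
    ⊎ (¬ IsLast i × E (σ i) (σ j) × (∀ k → E (σ i) (σ k) → k ≤ j))

  IsF : (Fin n → Fin n) → Fin n → Fin n → Set
  IsF σ u v = Σ (Fin n) λ i → Σ (Fin n) λ j → σ i ≡ u × σ j ≡ v × FPos σ i j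

  -- edges of the block tree T(G) corresponding to σ
  TreeEdge : (Fin n → Fin n) → Fin n → Fin n → Set
  TreeEdge σ u v = u ≢ v × (IsF σ u v ⊎ IsF σ v u)

-- BFS orderings of a graph with adjacency A, started at r (queue-based BFS):
-- τ lists r first; every later vertex has an earlier neighbour, and the position
-- of the earliest earlier neighbour (the vertex from which it was discovered)
-- is nondecreasing along τ.
module _ {n : ℕ} (A : Fin n → Fin n → Set) where
  EarliestNb : (Fin n → Fin n) → Fin n → Fin n → Set
  EarliestNb τ k p = p < k × A (τ p) (τ k) × (∀ q → q < k → A (τ q) (τ k) → p ≤ q)

  IsBFS : Fin n → (Fin n → Fin n) → Set
  IsBFS r τ = IsOrdering τ
    × (∀ i → IsFirst i → τ i ≡ r)
    × (∀ k → ¬ IsFirst k → ∃ λ p → EarliestNb τ k p)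
    × (∀ k l p q → k ≤ l → EarliestNb τ k p → EarliestNb τ l q → p ≤ q)

rev : {n : ℕ} → (Fin n → Fin n) → (Fin n → Fin n)
rev τ k = τ (opposite k)

module _ {n : ℕ} (G : Graph n) where
  open Graph G
  ClosedNbhdFrom : (Fin n → Fin n) → Fin n → Fin n → Fin n → Set
  ClosedNbhdFrom β i k x =
    (Σ (Fin n) λ t → i ≤ t × E (β k) (β t) × x ≡ β t) ⊎ x ≡ β k

{-# OPTIONS --safe #-}
-- In β a vertex's later neighbours are its earlier neighbours in the BFS order τ of the block
-- tree, and the tree parent F(v) precedes v in τ; so none of them has that vertex as its F.
-- It therefore suffices that two neighbours y, z of w, neither with F = w, are adjacent. If
-- both follow w in the BEO σ this is the BEO condition. If y precedes w, then F(y) lies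
-- beyond w in σ and is adjacent to both, and the BEO condition completes a diamond
-- p∼q, p∼r, q∼r, q∼s, r∼s with p ≠ s. In a block graph this forces p∼s: the set
-- {p, q, r, s} has no cut vertex, hence lies in a single block, which is complete.
--
-- The block containing such a set D is the union of all finite sets T ⊇ D in which no single
-- vertex u separates a vertex of T from D ∖ {u}. These "anchored" sets are closed under
-- union, and anchored sets are connected without cut vertex. Maximality: inside a larger
-- connected set without cut vertex, D ∪ {x} is saturated to an anchored set by repeatedly
-- adding the vertices of the walks avoiding u, which terminates by finiteness.
module Submission where

open import Defs
open import Data.Nat as ℕ using (ℕ; zero; suc)
import Data.Nat.Properties as ℕ
open import Data.Fin as Fin using (Fin; _≤_; _<_; _≟_; opposite)
open import Data.Fin.Properties
  using (≤fromℕ; ≤-refl; ≤-antisym; <-cmp; <⇒≢; ≤∧≢⇒<; _≤?_; all?; opposite-prop; opposite-involutive)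
open import Data.Fin.Induction using (<-wellFounded)
open import Data.Fin.Subset using (Subset; _∈_; _∉_; _⊆_; _⊂_; _⊃_; _∪_; ⁅_⁆)
open import Data.Fin.Subset.Properties
  using (_∈?_; ⊆-refl; x∈⁅x⁆; x∈⁅y⁆⇒x≡y; x∈p∪q⁺; x∈p∪q⁻; p⊆p∪q; q⊆p∪q)
open import Data.Fin.Subset.Induction using (⊃-wellFounded)
open import Induction.WellFounded using (Acc; acc)
open import Data.Product using (∃; _×_; _,_; proj₁; proj₂)
open import Data.Sum using (_⊎_; inj₁; inj₂; [_,_]; map₁; map₂)
open import Function using (_∘_)
open import Relation.Nullary using (¬_; yes; no; contradiction)
open import Relation.Nullary.Decidable using (¬?; decidable-stable)
open import Relation.Unary using (Decidable; _∩_)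
open import Relation.Binary.PropositionalEquality
  using (_≡_; _≢_; refl; sym; trans; cong; subst; subst₂)
open import Relation.Binary.Definitions using (tri<; tri≈; tri>)

∀⊎-pull : ∀ {n} {A : Fin n → Set} {B : Set} → (∀ i → A i ⊎ B) → (∀ i → A i) ⊎ B
∀⊎-pull {zero} f = inj₁ λ ()
∀⊎-pull {suc n} f with f Fin.zero | ∀⊎-pull (f ∘ Fin.suc)
... | inj₂ b | _ = inj₂ b
... | inj₁ _ | inj₂ b = inj₂ b
... | inj₁ a | inj₁ as = inj₁ λ { Fin.zero → a ; (Fin.suc i) → as i }

⊆-∪⁅⁆ : ∀ {n} {P : Fin n → Set} {T : Subset n} {x} →
  (∀ {z} → z ∈ T → P z) → P x → ∀ {z} → z ∈ T ∪ ⁅ x ⁆ → P z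
⊆-∪⁅⁆ {P = P} {T} {x} T⊆P Px =
  [ T⊆P , (λ z∈x → subst P (sym (x∈⁅y⁆⇒x≡y x z∈x)) Px) ] ∘ x∈p∪q⁻ T ⁅ x ⁆

p⊂p∪⁅x⁆ : ∀ {n} {p : Subset n} {x} → x ∉ p → p ⊂ p ∪ ⁅ x ⁆
p⊂p∪⁅x⁆ {p = p} {x} x∉p = (λ {_} → p⊆p∪q ⁅ x ⁆) , x , q⊆p∪q p ⁅ x ⁆ (x∈⁅x⁆ x) , x∉p

x∈⁅x⁆∪p : ∀ {n} {x : Fin n} p → x ∈ ⁅ x ⁆ ∪ p
x∈⁅x⁆∪p p = x∈p∪q⁺ (inj₁ (x∈⁅x⁆ _))

x∈p⇒x∈⁅y⁆∪p : ∀ {n} {x y : Fin n} {p} → x ∈ p → x ∈ ⁅ y ⁆ ∪ p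
x∈p⇒x∈⁅y⁆∪p = q⊆p∪q _ _

x∈⁅y⁆∪p⁻ : ∀ {n} {x y : Fin n} p → x ∈ ⁅ y ⁆ ∪ p → x ≡ y ⊎ x ∈ p
x∈⁅y⁆∪p⁻ p = map₁ (x∈⁅y⁆⇒x≡y _) ∘ x∈p∪q⁻ _ p

opposite-antitone : ∀ {n} {i j : Fin n} → i ≤ j → opposite j ≤ opposite i
opposite-antitone {n} {i} {j} i≤j =
  subst₂ ℕ._≤_ (sym (opposite-prop j)) (sym (opposite-prop i)) (ℕ.∸-monoʳ-≤ n (ℕ.s≤s i≤j))

opposite-injective : ∀ {n} {i j : Fin n} → opposite i ≡ opposite j → i ≡ j
opposite-injective {i = i} {j} eq =
  trans (sym (opposite-involutive i)) (trans (cong opposite eq) (opposite-involutive j))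

module Walks {n : ℕ} (G : Graph n) where
  open Graph G using () renaming (sym to E-sym)

  Reach-map : ∀ {P Q : Fin n → Set} {u v} → (∀ {z} → P z → Q z) → Reach G P u v → Reach G Q u v
  Reach-map f here = here
  Reach-map f (step e pw r) = step e (f pw) (Reach-map f r)

  infixr 5 _◅◅_
  _◅◅_ : ∀ {P : Fin n → Set} {u v w} → Reach G P u v → Reach G P v w → Reach G P u w
  here ◅◅ r′ = r′
  step e pw r ◅◅ r′ = step e pw (r ◅◅ r′)

  Reach-reverse : ∀ {P : Fin n → Set} {u v} → P u → Reach G P u v → Reach G P v u
  Reach-reverse pu here = here
  Reach-reverse pu (step e pw r) = Reach-reverse pw r ◅◅ step (E-sym _ _ e) pu here

  Reach-restrict : ∀ {P Q : Fin n → Set} {u v} → Decidable Q → Reach G P u v →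
    Reach G (P ∩ Q) u v ⊎ ∃ λ z → P z × ¬ Q z
  Reach-restrict Q? here = inj₁ here
  Reach-restrict Q? (step {w = w} e pw r) with Q? w
  ... | no ¬Qw = inj₂ (w , pw , ¬Qw)
  ... | yes Qw = map₁ (step e (pw , Qw)) (Reach-restrict Q? r)

module _ {n : ℕ} (G : Graph n) where
  open Graph G using (E)
  open Walks G

  Dominating : (Fin n → Set) → Fin n → Set
  Dominating P h = ∀ {y} → P y → y ≡ h ⊎ E y h

  dominated⇒connected : ∀ {P h} → P h → Dominating P h → ConnectedOn G P
  dominated⇒connected {P} {h} Ph dom y w Py Pw = to-h Py ◅◅ Reach-reverse Pw (to-h Pw)
    where
    to-h : ∀ {y} → P y → Reach G P y h
    to-h Py with dom Py
    ... | inj₁ refl = here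
    ... | inj₂ y~h = step y~h Ph here

  twice-dominated⇒noCutVertex : ∀ {P h h′} → P h → P h′ → h ≢ h′ →
    Dominating P h → Dominating P h′ → NoCutVertex G P
  twice-dominated⇒noCutVertex {h = h} Ph Ph′ h≢h′ dom dom′ v _ with h ≟ v
  ... | no h≢v = dominated⇒connected (Ph , h≢v) (dom ∘ proj₁)
  ... | yes refl = dominated⇒connected (Ph′ , h≢h′ ∘ sym) (dom′ ∘ proj₁)

module BlockConstruction {n : ℕ} (G : Graph n) (D : Subset n) {a b : Fin n}
  (a∈D : a ∈ D) (b∈D : b ∈ D) (a≢b : a ≢ b)
  (D-connected : ConnectedOn G (_∈ D)) (D-noCut : NoCutVertex G (_∈ D)) where
  open Walks G

  AnchorWalk : (Fin n → Set) → Fin n → Fin n → Set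
  AnchorWalk P y u = ∃ λ d → d ∈ D × d ≢ u × Reach G (λ z → P z × z ≢ u) y d

  Anchored : (Fin n → Set) → Set
  Anchored P = ∀ {y u} → P y → y ≢ u → AnchorWalk P y u

  D-anchored : Anchored (_∈ D)
  D-anchored {y} y∈D y≢u = y , y∈D , y≢u , here

  other-than : ∀ u → ∃ λ d → d ∈ D × d ≢ u
  other-than u with a ≟ u
  ... | yes refl = b , b∈D , a≢b ∘ sym
  ... | no a≢u = a , a∈D , a≢u

  D-avoiding : ∀ {v d d′} → d ∈ D → d′ ∈ D → d ≢ v → d′ ≢ v →
    Reach G (λ z → z ∈ D × z ≢ v) d d′
  D-avoiding {v} d∈D d′∈D d≢v d′≢v with v ∈? D
  ... | yes v∈D = D-noCut v v∈D _ _ (d∈D , d≢v) (d′∈D , d′≢v)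
  ... | no v∉D = Reach-map (λ z∈D → z∈D , λ { refl → v∉D z∈D }) (D-connected _ _ d∈D d′∈D)

  module _ {P : Fin n → Set} (D⊆P : ∀ {z} → z ∈ D → P z) where

    2-connected⇒anchored : ConnectedOn G P → NoCutVertex G P → Anchored P
    2-connected⇒anchored conn noCut {y} {u} Py y≢u with other-than u
    ... | d , d∈D , d≢u with Reach-restrict (λ z → ¬? (z ≟ u)) (conn y d Py (D⊆P d∈D))
    ...   | inj₁ r = d , d∈D , d≢u , r
    ...   | inj₂ (z , Pz , ¬z≢u) = d , d∈D , d≢u , noCut u Pu y d (Py , y≢u) (D⊆P d∈D , d≢u)
      where
      Pu : P u
      Pu = subst P (decidable-stable (z ≟ u) ¬z≢u) Pz

    anchored⇒reaches-D : Anchored P → ∀ {y} → P y → ∃ λ d → d ∈ D × Reach G P y d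
    anchored⇒reaches-D anch {y} Py with y ≟ a
    ... | yes refl = a , a∈D , here
    ... | no y≢a with anch Py y≢a
    ...   | d , d∈D , _ , r = d , d∈D , Reach-map proj₁ r

    anchored⇒connected : Anchored P → ConnectedOn G P
    anchored⇒connected anch y w Py Pw
      with anchored⇒reaches-D anch Py | anchored⇒reaches-D anch Pw
    ... | d , d∈D , r | d′ , d′∈D , r′ =
      r ◅◅ Reach-map D⊆P (D-connected d d′ d∈D d′∈D) ◅◅ Reach-reverse Pw r′

    anchored⇒noCutVertex : Anchored P → NoCutVertex G P
    anchored⇒noCutVertex anch v _ y w (Py , y≢v) (Pw , w≢v) with anch Py y≢v | anch Pw w≢v
    ... | d , d∈D , d≢v , r | d′ , d′∈D , d′≢v , r′ =
      r ◅◅ Reach-map (λ (z∈D , z≢v) → D⊆P z∈D , z≢v) (D-avoiding d∈D d′∈D d≢v d′≢v)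
        ◅◅ Reach-reverse (Pw , w≢v) r′

  module Saturation {P : Fin n → Set} (P-anchored : Anchored P) where

    anchoredAt-or-exit : ∀ {T} → (∀ {z} → z ∈ T → P z) → ∀ y u →
      (y ∈ T → y ≢ u → AnchorWalk (_∈ T) y u) ⊎ ∃ λ z → z ∉ T × P z
    anchoredAt-or-exit {T} T⊆P y u with y ∈? T | y ≟ u
    ... | no y∉T | _ = inj₁ λ y∈T → contradiction y∈T y∉T
    ... | yes _ | yes refl = inj₁ λ _ y≢y → contradiction refl y≢y
    ... | yes y∈T | no y≢u with P-anchored (T⊆P y∈T) y≢u
    ...   | d , d∈D , d≢u , r with Reach-restrict (_∈? T) r
    ...     | inj₁ r′ = inj₁ λ _ _ → d , d∈D , d≢u , Reach-map (λ ((_ , z≢u) , z∈T) → z∈T , z≢u) r′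
    ...     | inj₂ (z , (Pz , _) , z∉T) = inj₂ (z , z∉T , Pz)

    anchored-or-exit : ∀ {T} → (∀ {z} → z ∈ T → P z) → Anchored (_∈ T) ⊎ ∃ λ z → z ∉ T × P z
    anchored-or-exit T⊆P =
      map₁ (λ anch {y} {u} → anch y u) (∀⊎-pull λ y → ∀⊎-pull (anchoredAt-or-exit T⊆P y))

    saturate : ∀ T → (∀ {z} → z ∈ T → P z) → ∃ λ T′ → T ⊆ T′ × Anchored (_∈ T′)
    saturate T = go T (⊃-wellFounded T)
      where
      go : ∀ T → Acc _⊃_ T → (∀ {z} → z ∈ T → P z) → ∃ λ T′ → T ⊆ T′ × Anchored (_∈ T′)
      go T (acc rec) T⊆P with anchored-or-exit T⊆P
      ... | inj₁ anch = T , ⊆-refl , anch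
      ... | inj₂ (z , z∉T , Pz) =
        let T′ , T∪z⊆T′ , anch = go (T ∪ ⁅ z ⁆) (rec (p⊂p∪⁅x⁆ z∉T)) (⊆-∪⁅⁆ T⊆P Pz)
        in T′ , (λ {_} → T∪z⊆T′ ∘ p⊆p∪q ⁅ z ⁆) , anch

  -- T ranges over decidable subsets rather than predicates so that Block stays in Set.
  Block : Fin n → Set
  Block x = ∃ λ T → D ⊆ T × Anchored (_∈ T) × x ∈ T

  D⊆Block : ∀ {x} → x ∈ D → Block x
  D⊆Block x∈D = D , ⊆-refl , D-anchored , x∈D

  Block-anchored : Anchored Block
  Block-anchored (T , D⊆T , anch , y∈T) y≢u with anch y∈T y≢u
  ... | d , d∈D , d≢u , r =
    d , d∈D , d≢u , Reach-map (λ (z∈T , z≢u) → (T , D⊆T , anch , z∈T) , z≢u) r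

  Block-maximal : ∀ S → (∀ x → Block x → S x) → ConnectedOn G S → NoCutVertex G S →
    ∀ x → S x → Block x
  Block-maximal S Block⊆S conn noCut x Sx =
    let T , D∪x⊆T , anch = saturate (D ∪ ⁅ x ⁆) (⊆-∪⁅⁆ D⊆S Sx)
    in T , (λ {_} → D∪x⊆T ∘ p⊆p∪q ⁅ x ⁆) , anch , D∪x⊆T (q⊆p∪q D ⁅ x ⁆ (x∈⁅x⁆ x))
    where
    D⊆S : ∀ {z} → z ∈ D → S z
    D⊆S = Block⊆S _ ∘ D⊆Block
    open Saturation (2-connected⇒anchored D⊆S conn noCut)

  Block-isBlock : IsBlock G Block
  Block-isBlock =
    (a , D⊆Block a∈D) ,
    anchored⇒connected D⊆Block Block-anchored ,
    anchored⇒noCutVertex D⊆Block Block-anchored ,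
    Block-maximal

module _ {n : ℕ} (G : Graph n) (blockGraph : IsBlockGraph G) where
  open Graph G renaming (sym to E-sym)

  2-connected⇒complete : (D : Subset n) {a b : Fin n} → a ∈ D → b ∈ D → a ≢ b →
    ConnectedOn G (_∈ D) → NoCutVertex G (_∈ D) →
    ∀ {x y} → x ∈ D → y ∈ D → x ≢ y → E x y
  2-connected⇒complete D a∈D b∈D a≢b conn noCut x∈D y∈D =
    proj₂ blockGraph Block Block-isBlock _ _ (D⊆Block x∈D) (D⊆Block y∈D)
    where open BlockConstruction G D a∈D b∈D a≢b conn noCut

  diamond : ∀ {p q r s} → E p q → E p r → E q r → E q s → E r s → p ≢ s → E p s
  diamond {p} {q} {r} {s} p~q p~r q~r q~s r~s =
    2-connected⇒complete D q∈D r∈D q≢r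
      (dominated⇒connected G q∈D dominated-by-q)
      (twice-dominated⇒noCutVertex G q∈D r∈D q≢r dominated-by-q dominated-by-r)
      p∈D s∈D
    where
    D : Subset n
    D = ⁅ p ⁆ ∪ ⁅ q ⁆ ∪ ⁅ r ⁆ ∪ ⁅ s ⁆

    p∈D : p ∈ D
    p∈D = x∈⁅x⁆∪p _
    q∈D : q ∈ D
    q∈D = x∈p⇒x∈⁅y⁆∪p (x∈⁅x⁆∪p _)
    r∈D : r ∈ D
    r∈D = x∈p⇒x∈⁅y⁆∪p (x∈p⇒x∈⁅y⁆∪p (x∈⁅x⁆∪p _))
    s∈D : s ∈ D
    s∈D = x∈p⇒x∈⁅y⁆∪p (x∈p⇒x∈⁅y⁆∪p (x∈p⇒x∈⁅y⁆∪p (x∈⁅x⁆ s)))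

    members : ∀ {x} → x ∈ D → x ≡ p ⊎ x ≡ q ⊎ x ≡ r ⊎ x ≡ s
    members = map₂ (map₂ (map₂ (x∈⁅y⁆⇒x≡y s) ∘ x∈⁅y⁆∪p⁻ _) ∘ x∈⁅y⁆∪p⁻ _) ∘ x∈⁅y⁆∪p⁻ _

    q≢r : q ≢ r
    q≢r refl = irrefl q q~r

    dominated-by-q : Dominating G (_∈ D) q
    dominated-by-q x∈D with members x∈D
    ... | inj₁ refl = inj₂ p~q
    ... | inj₂ (inj₁ refl) = inj₁ refl
    ... | inj₂ (inj₂ (inj₁ refl)) = inj₂ (E-sym _ _ q~r)
    ... | inj₂ (inj₂ (inj₂ refl)) = inj₂ (E-sym _ _ q~s)

    dominated-by-r : Dominating G (_∈ D) r
    dominated-by-r x∈D with members x∈D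
    ... | inj₁ refl = inj₂ p~r
    ... | inj₂ (inj₁ refl) = inj₂ q~r
    ... | inj₂ (inj₂ (inj₁ refl)) = inj₁ refl
    ... | inj₂ (inj₂ (inj₂ refl)) = inj₂ (E-sym _ _ r~s)

module _ {n : ℕ} (G : Graph n) {σ : Fin n → Fin n} (σ-injective : IsOrdering σ) where

  FPos-functional : ∀ {i j j′} → FPos G σ i j → FPos G σ i j′ → j ≡ j′
  FPos-functional (inj₁ (_ , refl)) (inj₁ (_ , refl)) = refl
  FPos-functional (inj₁ (i-last , _)) (inj₂ (i-not-last , _)) = contradiction i-last i-not-last
  FPos-functional (inj₂ (i-not-last , _)) (inj₁ (i-last , _)) = contradiction i-last i-not-last
  FPos-functional (inj₂ (_ , i~j , j-max)) (inj₂ (_ , i~j′ , j′-max)) =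
    ≤-antisym (j′-max _ i~j) (j-max _ i~j′)

  IsF-functional : ∀ {u v v′} → IsF G σ u v → IsF G σ u v′ → v ≡ v′
  IsF-functional (i , j , refl , refl , Fi) (i′ , j′ , σi′≡σi , refl , Fi′)
    with σ-injective σi′≡σi
  ... | refl = cong σ (FPos-functional Fi Fi′)

module BlockEliminationOrdering {n : ℕ} (G : Graph n) (blockGraph : IsBlockGraph G)
  (σ : Fin n → Fin n) (beo : IsBEO G σ) where
  open Graph G renaming (sym to E-sym)

  infix 4 _~_
  _~_ : Fin n → Fin n → Set
  i ~ j = E (σ i) (σ j)

  ~-sym : ∀ {i j} → i ~ j → j ~ i
  ~-sym = E-sym _ _

  later-neighbours-adjacent : ∀ {i j k} → i < j → i < k → j ≢ k → i ~ j → i ~ k → j ~ k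
  later-neighbours-adjacent i<j i<k j≢k i~j i~k with <-cmp _ _
  ... | tri< j<k _ _ = proj₂ beo _ _ _ i<j j<k i~j i~k
  ... | tri≈ _ j≡k _ = contradiction j≡k j≢k
  ... | tri> _ _ k<j = ~-sym (proj₂ beo _ _ _ i<k k<j i~k i~j)

  diamond~ : ∀ {i j k l} → i ~ j → i ~ k → j ~ k → j ~ l → k ~ l → i ≢ l → i ~ l
  diamond~ i~j i~k j~k j~l k~l i≢l = diamond G blockGraph i~j i~k j~k j~l k~l (i≢l ∘ proj₁ beo)

  F-beyond : ∀ {i j f} → i < j → i ~ j → FPos G σ i f → f ≢ j → j < f × j ~ f × i ~ f
  F-beyond i<j i~j (inj₁ (i-last , _)) _ = contradiction (i-last _) (ℕ.<⇒≱ i<j)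
  F-beyond {j = j} {f} i<j i~j (inj₂ (_ , i~f , f-max)) f≢j =
    j<f , proj₂ beo _ _ _ i<j j<f i~j i~f , i~f
    where
    j<f : j < f
    j<f = ≤∧≢⇒< (f-max _ i~j) (f≢j ∘ sym)

  increasing-path-shortcut : ∀ {i j k f} → i < j → j < k → i ~ j → j ~ k →
    FPos G σ i f → f ≢ j → i ~ k
  increasing-path-shortcut {k = k} {f} i<j j<k i~j j~k Fi f≢j with F-beyond i<j i~j Fi f≢j
  ... | j<f , j~f , i~f with k ≟ f
  ...   | yes refl = i~f
  ...   | no k≢f = diamond~ i~j i~f j~f j~k
    (~-sym (later-neighbours-adjacent j<k j<f k≢f j~k j~f)) (<⇒≢ (ℕ.<-trans i<j j<k))

  neighbours-adjacent : ∀ {i j k f g} → i ~ j → i ~ k → j ≢ k →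
    FPos G σ j f → f ≢ i → FPos G σ k g → g ≢ i → j ~ k
  neighbours-adjacent {i} {j} {k} i~j i~k j≢k Fj f≢i Fk g≢i with <-cmp i j | <-cmp i k
  ... | tri≈ _ refl _ | _ = contradiction i~j (irrefl _)
  ... | _ | tri≈ _ refl _ = contradiction i~k (irrefl _)
  ... | tri< i<j _ _ | tri< i<k _ _ = later-neighbours-adjacent i<j i<k j≢k i~j i~k
  ... | tri> _ _ j<i | tri< i<k _ _ = increasing-path-shortcut j<i i<k (~-sym i~j) i~k Fj f≢i
  ... | tri< i<j _ _ | tri> _ _ k<i = ~-sym (increasing-path-shortcut k<i i<j (~-sym i~k) i~j Fk g≢i)
  ... | tri> _ _ j<i | tri> _ _ k<i with F-beyond k<i (~-sym i~k) Fk g≢i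
  ...   | i<g , i~g , k~g = diamond~ (~-sym i~j)
    (increasing-path-shortcut j<i i<g (~-sym i~j) i~g Fj f≢i) i~g i~k (~-sym k~g) j≢k

  neighbours-adjacentᵛ : ∀ {i w y z y′ z′} → σ i ≡ w → E w y → E w z → y ≢ z →
    IsF G σ y y′ → y′ ≢ w → IsF G σ z z′ → z′ ≢ w → E y z
  neighbours-adjacentᵛ refl w~y w~z y≢z
    (_ , _ , refl , refl , Fy) y′≢w (_ , _ , refl , refl , Fz) z′≢w =
    neighbours-adjacent w~y w~z (y≢z ∘ cong σ) Fy (y′≢w ∘ cong σ) Fz (z′≢w ∘ cong σ)

module ReverseBFS {n : ℕ} (G : Graph n) (blockGraph : IsBlockGraph G)
  (σ : Fin n → Fin n) (beo : IsBEO G σ) {r : Fin n} (r-last : IsLast r)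
  (τ : Fin n → Fin n) (bfs : IsBFS (TreeEdge G σ) (σ r) τ) where
  open Graph G using (E; irrefl)
  open BlockEliminationOrdering G blockGraph σ beo using (neighbours-adjacentᵛ)

  τ-injective : IsOrdering τ
  τ-injective = proj₁ bfs

  parent-precedes : ∀ k → ∃ λ l → l ≤ k × IsF G σ (τ k) (τ l)
  parent-precedes k = go k (<-wellFounded k)
    where
    go : ∀ k → Acc _<_ k → ∃ λ l → l ≤ k × IsF G σ (τ k) (τ l)
    go k (acc rec) with all? (k ≤?_)
    ... | yes k-first =
      k , ≤-refl , r , r , sym τk≡σr , sym τk≡σr , inj₁ (r-last , refl)
      where
      τk≡σr : τ k ≡ σ r
      τk≡σr = proj₁ (proj₂ bfs) k k-first
    ... | no k-not-first with proj₁ (proj₂ (proj₂ bfs)) k k-not-first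
    ...   | p , p<k , (_ , inj₂ Fk≡p) , _ = p , ℕ.<⇒≤ p<k , Fk≡p
    ...   | p , p<k , (_ , inj₁ Fp≡k) , _ with go p (rec p<k)
    ...     | l , l≤p , Fp≡l with τ-injective (IsF-functional G (proj₁ beo) Fp≡l Fp≡k)
    ...       | refl = contradiction l≤p (ℕ.<⇒≱ p<k)

  earlier-neighbours-adjacent : ∀ {kw ky kz} → ky ≤ kw → kz ≤ kw → ky ≢ kz →
    E (τ kw) (τ ky) → E (τ kw) (τ kz) → E (τ ky) (τ kz)
  earlier-neighbours-adjacent {kw} {ky} {kz} ky≤kw kz≤kw ky≢kz w~y w~z
    with parent-precedes kw | parent-precedes ky | parent-precedes kz
  ... | _ , _ , _ , _ , σi≡w , _ | _ , l≤ky , Fy | _ , m≤kz , Fz =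
    neighbours-adjacentᵛ σi≡w w~y w~z (ky≢kz ∘ τ-injective)
      Fy (not-parent l≤ky ky≤kw w~y) Fz (not-parent m≤kz kz≤kw w~z)
    where
    not-parent : ∀ {l k k′} → l ≤ k → k ≤ k′ → E (τ k′) (τ k) → τ l ≢ τ k′
    not-parent {l} l≤k k≤k′ τk′~τk τl≡τk′ with τ-injective τl≡τk′
    ... | refl = irrefl _ (subst (λ x → E (τ l) (τ x)) (≤-antisym k≤k′ l≤k) τk′~τk)

  later-neighbours-adjacent : ∀ {i j t} → i ≤ j → i ≤ t → j ≢ t →
    E (rev τ i) (rev τ j) → E (rev τ i) (rev τ t) → E (rev τ j) (rev τ t)
  later-neighbours-adjacent i≤j i≤t j≢t =
    earlier-neighbours-adjacent (opposite-antitone i≤j) (opposite-antitone i≤t)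
      (j≢t ∘ opposite-injective)

lemma5 : {n : ℕ} (G : Graph n) → IsBlockGraph G
    → (σ : Fin n → Fin n) → IsBEO G σ
    → (τ : Fin n → Fin n) → (∀ r → IsLast r → IsBFS (TreeEdge G σ) (σ r) τ)
    → ∀ i j → i ≤ j → Graph.E G (rev τ i) (rev τ j)
    → ∀ x → ClosedNbhdFrom G (rev τ) i i x → ClosedNbhdFrom G (rev τ) i j x
lemma5 {zero} G blockGraph σ beo τ bfs () j i≤j βi~βj x x∈N[βi]
lemma5 {suc m} G blockGraph σ beo τ bfs i j i≤j βi~βj x (inj₂ x≡βi) =
  inj₁ (i , ≤-refl , Graph.sym G _ _ βi~βj , x≡βi)
lemma5 {suc m} G blockGraph σ beo τ bfs i j i≤j βi~βj x (inj₁ (t , i≤t , βi~βt , x≡βt)) with t ≟ j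
... | yes refl = inj₂ x≡βt
... | no t≢j = inj₁ (t , i≤t , later-neighbours-adjacent i≤j i≤t (t≢j ∘ sym) βi~βj βi~βt , x≡βt)
  where open ReverseBFS G blockGraph σ beo (≤fromℕ {m}) τ (bfs _ (≤fromℕ {m}))
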